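{- Let $P$ be a Laurent polynomial in $x_1,\ldots,x_r$ with integer coefficients, $p$ a prime, $m\geq\deg(P)-1$ an integer, $T=[-m,m]^r\cap\mathbb{Z}^r$, and let $\gamma(k)$ and $V(n)$ be as in the context. Then for all non-negative integers $n$ and all $k\in\{0,1,\ldots,p-1\}$, $$\gamma(k)\cdot V(n)=V(pn+k)$$ (as vectors over $\mathbb{F}_p$).
   Context: $\deg R$ is the largest absolute value of any exponent of any single variable in $R$. For $n\in\mathbb{N}$ and $k\in\mathbb{Z}^r$, $a^n_k$ denotes the coefficient of $x_1^{ -k_1}\cdots x_r^{ -k_r}$ in $P^n$. Fix an order on $T$. For $k\in\{0,\ldots,p-1\}$, $\gamma(k)$ is the $T\times T$ matrix over $\mathbb{F}_p$ with $(i,j)$ entry $a^k_{i-pj}\bmod p$. For $n\in\mathbb{N}$, $V(n)$ is the column vector $(a^n_i\bmod p)_{i\in T}\in\mathbb{F}_p^T$. -}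

module Defs where

open import Data.Nat as ℕ using (ℕ; zero; suc)
open import Data.Integer as ℤ using (ℤ; +_; -[1+_]; ∣_∣)
open import Data.Integer.Properties using (_≟_)
open import Data.Vec using (Vec; []; _∷_; zipWith; map; replicate)
open import Data.Vec.Properties using (≡-dec)
open import Data.List as List using (List; []; _∷_; concatMap; upTo; foldr)
open import Data.Product using (_×_; _,_)
open import Relation.Nullary using (yes; no)
open import Relation.Binary.PropositionalEquality using (_≢_)
open import Data.Vec.Relation.Unary.All using (All)
open import Data.Integer.Divisibility using (_∣_)

-- A Laurent polynomial in r variables with integer coefficients, given as a
-- finite list of terms (exponent vector, coefficient); the polynomial is the
-- sum of its terms (repeated exponents are allowed and are added up).
LaurentPoly : ℕ → Set
LaurentPoly r = List (Vec ℤ r × ℤ)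

coeff : ∀ {r} → LaurentPoly r → Vec ℤ r → ℤ
coeff [] e = + 0
coeff ((f , c) ∷ P) e with ≡-dec _≟_ f e
... | yes _ = c ℤ.+ coeff P e
... | no  _ = coeff P e

mul : ∀ {r} → LaurentPoly r → LaurentPoly r → LaurentPoly r
mul P Q = concatMap (λ { (f , c) → List.map (λ { (g , d) → (zipWith ℤ._+_ f g , c ℤ.* d) }) Q }) P

one : ∀ {r} → LaurentPoly r
one {r} = (replicate r (+ 0) , + 1) ∷ []

pow : ∀ {r} → LaurentPoly r → ℕ → LaurentPoly r
pow P zero    = one
pow P (suc n) = mul P (pow P n)

a : ∀ {r} → LaurentPoly r → ℕ → Vec ℤ r → ℤ
a P n k = coeff (pow P n) (map ℤ.-_ k)

-- deg P ≤ d, unfolded: every exponent of every single variable in every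
-- monomial of P with nonzero coefficient has absolute value ≤ d
-- (so "m ≥ deg P - 1" is DegLE P (m + 1)).
DegLE : ∀ {r} → LaurentPoly r → ℤ → Set
DegLE {r} P d = ∀ (e : Vec ℤ r) → coeff P e ≢ + 0 → All (λ x → + ∣ x ∣ ℤ.≤ d) e

range : ℤ → List ℤ
range (+ n)    = List.map (λ i → + i ℤ.- + n) (upTo (suc (n ℕ.+ n)))
range -[1+ _ ] = []

cube : (r : ℕ) → List ℤ → List (Vec ℤ r)
cube zero    R = [] ∷ []
cube (suc r) R = concatMap (λ x → List.map (x ∷_) (cube r R)) R

T : (r : ℕ) → ℤ → List (Vec ℤ r)
T r m = cube r (range m)

-- γ(k)_{i,j} = a^k_{i - p j}  (as an integer; reduction mod p is done in _≡_[mod_])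
γ : ∀ {r} → LaurentPoly r → ℕ → ℕ → Vec ℤ r → Vec ℤ r → ℤ
γ P p k i j = a P k (zipWith ℤ._-_ i (map (λ x → + p ℤ.* x) j))

V : ∀ {r} → LaurentPoly r → ℕ → Vec ℤ r → ℤ
V P n i = a P n i

matVec : ∀ {r} → List (Vec ℤ r) → (Vec ℤ r → Vec ℤ r → ℤ) → (Vec ℤ r → ℤ) → Vec ℤ r → ℤ
matVec Tset M v i = foldr (λ j acc → M i j ℤ.* v j ℤ.+ acc) (+ 0) Tset

_≡_[mod_] : ℤ → ℤ → ℕ → Set
x ≡ y [mod p ] = (+ p) ∣ (x ℤ.- y)

-- Modulo p the Frobenius map is additive, because p divides the inner binomial coefficients C(p, j).
-- Reducing every coefficient mod p to a natural number, i.e. a sum of ones, this gives Q^p ≡ Q(x^p) for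
-- every Laurent polynomial Q. With Q = P^n and R = P^k, P^(pn+k) = Q^p R ≡ Q(x^p) R, whose coefficient of x^(-i)
-- is the sum of a^n_j a^k_(i-pj) over all j ∈ ℤ^r. Only j ∈ T contribute: if |j_c| > m ≥ |i_c| then
-- |(i - pj)_c| ≥ p(m+1) - m > k(m+1) ≥ deg P^k, so a^k_(i-pj) = 0.

module Submission where

open import Defs
open import Algebra.Bundles using (CommutativeSemiring)
open import Data.Empty using (⊥-elim)
open import Data.Fin using (Fin; fromℕ; inject₁)
open import Data.Fin.Properties using (toℕ-fromℕ; toℕ-inject₁; toℕ<n)
open import Data.Nat using (ℕ; zero; suc; _<_; _≤_; z≤n; s≤s)
import Data.Nat as ℕ
open import Data.Nat.Combinatorics using (_C_; nCn≡1; nCk+nC[k+1]≡[n+1]C[k+1])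
import Data.Nat.Divisibility as ℕ
open import Data.Nat.Primality using (Prime; euclidsLemma; prime⇒nonZero)
import Data.Nat.Properties as ℕ
open import Data.Sum using (inj₁; inj₂)
open import Relation.Binary.PropositionalEquality
  using (_≡_; _≢_; refl; sym; trans; cong; cong₂; subst; subst₂; module ≡-Reasoning)

private variable
  A B : Set
  r : ℕ

[1+k]*[1+n]C[1+k]≡[1+n]*nCk : ∀ n k → suc k ℕ.* (suc n C suc k) ≡ suc n ℕ.* (n C k)
[1+k]*[1+n]C[1+k]≡[1+n]*nCk zero    zero    = refl
[1+k]*[1+n]C[1+k]≡[1+n]*nCk zero    (suc k) = ℕ.*-zeroʳ (suc (suc k))
[1+k]*[1+n]C[1+k]≡[1+n]*nCk (suc n) k       = begin
  suc k ℕ.* (suc (suc n) C suc k)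
    ≡⟨ cong (suc k ℕ.*_) (nCk+nC[k+1]≡[n+1]C[k+1] (suc n) k) ⟨
  suc k ℕ.* (suc n C k ℕ.+ suc n C suc k)
    ≡⟨ ℕ.*-distribˡ-+ (suc k) (suc n C k) _ ⟩
  suc k ℕ.* (suc n C k) ℕ.+ suc k ℕ.* (suc n C suc k)
    ≡⟨ cong (suc k ℕ.* (suc n C k) ℕ.+_) ([1+k]*[1+n]C[1+k]≡[1+n]*nCk n k) ⟩
  suc k ℕ.* (suc n C k) ℕ.+ suc n ℕ.* (n C k)
    ≡⟨ absorb k ⟩
  suc (suc n) ℕ.* (suc n C k) ∎
  where
  open ≡-Reasoning
  absorb : ∀ k → suc k ℕ.* (suc n C k) ℕ.+ suc n ℕ.* (n C k) ≡ suc (suc n) ℕ.* (suc n C k)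
  absorb zero    = refl
  absorb (suc k) = begin
    suc (suc k) ℕ.* (suc n C suc k) ℕ.+ suc n ℕ.* (n C suc k)
      ≡⟨ ℕ.+-assoc (suc n C suc k) _ _ ⟩
    suc n C suc k ℕ.+ (suc k ℕ.* (suc n C suc k) ℕ.+ suc n ℕ.* (n C suc k))
      ≡⟨ cong (λ z → suc n C suc k ℕ.+ (z ℕ.+ suc n ℕ.* (n C suc k))) ([1+k]*[1+n]C[1+k]≡[1+n]*nCk n k) ⟩
    suc n C suc k ℕ.+ (suc n ℕ.* (n C k) ℕ.+ suc n ℕ.* (n C suc k))
      ≡⟨ cong (suc n C suc k ℕ.+_) (ℕ.*-distribˡ-+ (suc n) (n C k) _) ⟨
    suc n C suc k ℕ.+ suc n ℕ.* (n C k ℕ.+ n C suc k)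
      ≡⟨ cong (λ z → suc n C suc k ℕ.+ suc n ℕ.* z) (nCk+nC[k+1]≡[n+1]C[k+1] n k) ⟩
    suc (suc n) ℕ.* (suc n C suc k) ∎

p∣pCk : ∀ {p k} → Prime p → 0 < k → k < p → p ℕ.∣ p C k
p∣pCk {suc n} {suc k} p-prime _ k<p
  with euclidsLemma (suc k) (suc n C suc k) p-prime
         (ℕ.divides (n C k) (trans ([1+k]*[1+n]C[1+k]≡[1+n]*nCk n k) (ℕ.*-comm (suc n) (n C k))))
... | inj₁ p∣1+k = ⊥-elim (ℕ.<⇒≱ k<p (ℕ.∣⇒≤ p∣1+k))
... | inj₂ p∣C   = p∣C

module Frobenius {c ℓ} (S : CommutativeSemiring c ℓ) where

  open CommutativeSemiring S hiding (zero) renaming (refl to ≈-refl; sym to ≈-sym; trans to ≈-trans)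
  open import Algebra.Properties.Semiring.Mult semiring
  open import Algebra.Properties.Semiring.Exp semiring
  open import Algebra.Properties.Monoid.Sum +-monoid using (sum; sum-cong-≋; sum-replicate-zero; sum-init-last)
  import Algebra.Properties.CommutativeSemiring.Binomial S as Binomial
  open import Relation.Binary.Reasoning.Setoid setoid

  n×x≈0 : ∀ {p n} → (∀ z → p × z ≈ 0#) → p ℕ.∣ n → ∀ x → n × x ≈ 0#
  n×x≈0 {p} p×z≈0 (ℕ.divides q refl) x = begin
    (q ℕ.* p) × x ≡⟨ cong (_× x) (ℕ.*-comm q p) ⟩
    (p ℕ.* q) × x ≈⟨ ×-assocˡ x p q ⟨
    p × (q × x)   ≈⟨ p×z≈0 (q × x) ⟩
    0#            ∎

  freshman's-dream : ∀ {p} → Prime p → (∀ z → p × z ≈ 0#) → ∀ x y → (x + y) ^ p ≈ x ^ p + y ^ p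
  freshman's-dream {zero}  ()
  freshman's-dream {suc m} p-prime p×z≈0 x y = begin
    (x + y) ^ suc m                                     ≈⟨ Binomial.theorem (suc m) x y ⟩
    term Fin.zero + sum (λ i → term (Fin.suc i))        ≈⟨ +-congˡ (sum-init-last (λ i → term (Fin.suc i))) ⟩
    term Fin.zero + (sum middle + term (fromℕ (suc m))) ≈⟨ +-congˡ (+-congʳ (sum≈0 middle≈0)) ⟩
    term Fin.zero + (0# + term (fromℕ (suc m)))         ≈⟨ +-cong first (+-identityˡ _) ⟩
    y ^ suc m + term (fromℕ (suc m))                    ≈⟨ +-congˡ last ⟩
    y ^ suc m + x ^ suc m                               ≈⟨ +-comm _ _ ⟩
    x ^ suc m + y ^ suc m                               ∎
    where
    term = Binomial.binomialTerm x y (suc m)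
    middle : Fin m → Carrier
    middle i = term (Fin.suc (inject₁ i))
    middle≈0 : ∀ i → middle i ≈ 0#
    middle≈0 i = n×x≈0 p×z≈0 (p∣pCk p-prime (s≤s z≤n) (s≤s (subst (_< m) (sym (toℕ-inject₁ i)) (toℕ<n i)))) _
    sum≈0 : ∀ {n} {t : Fin n → Carrier} → (∀ i → t i ≈ 0#) → sum t ≈ 0#
    sum≈0 {n} t≈0 = ≈-trans (sum-cong-≋ t≈0) (sum-replicate-zero n)
    first : term Fin.zero ≈ y ^ suc m
    first = ≈-trans (×-homo-1 _) (*-identityˡ _)
    last : term (fromℕ (suc m)) ≈ x ^ suc m
    last rewrite toℕ-fromℕ m | nCn≡1 (suc m) | ℕ.n∸n≡0 m = ≈-trans (×-homo-1 _) (*-identityʳ _)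

  0#^p≈0# : ∀ {p} → Prime p → 0# ^ p ≈ 0#
  0#^p≈0# {zero}  ()
  0#^p≈0# {suc m} _ = zeroˡ _

  [n×x]^p≈n×x^p : ∀ {p} → Prime p → (∀ z → p × z ≈ 0#) → ∀ n x → (n × x) ^ p ≈ n × x ^ p
  [n×x]^p≈n×x^p p-prime p×z≈0 zero    x = 0#^p≈0# p-prime
  [n×x]^p≈n×x^p p-prime p×z≈0 (suc n) x = ≈-trans (freshman's-dream p-prime p×z≈0 x (n × x))
                                               (+-congˡ ([n×x]^p≈n×x^p p-prime p×z≈0 n x))

open import Algebra.Structures.Biased using (isCommutativeMonoidˡ; isCommutativeSemiringˡ)
open import Data.Integer using (ℤ; +_; -[1+_]; _+_; -_; _-_; _*_; ∣_∣) renaming (_⊖_ to _⊖ℕ_)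
open import Data.Integer.DivMod using (_%ℕ_; _/ℕ_; a≡a%ℕn+[a/ℕn]*n)
import Data.Integer.Divisibility.Signed as ℤ
import Data.Integer.Properties as ℤ
open import Data.Integer.Properties using (_≟_)
open import Data.Integer.Tactic.RingSolver using (solve-∀)
open import Data.List using (List; []; _∷_; _++_; foldr; concatMap)
import Data.List as List
import Data.List.Properties as List
open import Data.List.Membership.Propositional using (_∈_; _∉_; find)
open import Data.List.Membership.Propositional.Properties using (∈-map⁺; ∈-map⁻; ∈-concatMap⁻; ∈-upTo⁺; ∈-upTo⁻)
open import Data.List.Relation.Unary.All.Properties using (All¬⇒¬Any)
open import Data.List.Relation.Unary.AllPairs using ([]; _∷_)
import Data.List.Relation.Unary.Any as Anyₗ
open import Data.List.Relation.Unary.Unique.Propositional using (Unique)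
import Data.List.Relation.Unary.Unique.Propositional.Properties as Unique
open import Data.Product using (Σ; _,_)
import Data.Product as Product
open import Data.Vec using (Vec; []; _∷_; zipWith; map; replicate)
import Data.Vec.Properties as Vec
open import Data.Vec.Properties using (≡-dec)
open import Data.Vec.Relation.Binary.Pointwise.Inductive using (Pointwise-≡⇒≡; zipWith-comm; zipWith-assoc; zipWith-identityˡ)
open import Data.Vec.Relation.Unary.All using (All; []; _∷_)
import Data.Vec.Relation.Unary.All as All
open import Data.Vec.Relation.Unary.Any using (Any; here; there)
open import Level using (0ℓ)
open import Relation.Binary.Structures using (IsEquivalence)
open import Relation.Nullary using (¬_; Dec; yes; no; contradiction)

-- The same fold as in matVec, so that matVec T M v i is ∑[ j ∈ T ] M i j * v j by definition.
infixr 5 ∑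
∑ : {A : Set} → List A → (A → ℤ) → ℤ
∑ xs w = foldr (λ x s → w x + s) (+ 0) xs

syntax ∑ xs (λ x → w) = ∑[ x ∈ xs ] w

∑-cong : ∀ (xs : List A) {v w : A → ℤ} → (∀ x → v x ≡ w x) → ∑ xs v ≡ ∑ xs w
∑-cong []       v≗w = refl
∑-cong (x ∷ xs) v≗w = cong₂ _+_ (v≗w x) (∑-cong xs v≗w)

∑-++ : ∀ (xs ys : List A) (w : A → ℤ) → ∑ (xs ++ ys) w ≡ ∑ xs w + ∑ ys w
∑-++ []       ys w = sym (ℤ.+-identityˡ _)
∑-++ (x ∷ xs) ys w = trans (cong (_+_ (w x)) (∑-++ xs ys w)) (sym (ℤ.+-assoc (w x) _ _))

∑-zero : ∀ (xs : List A) → ∑[ x ∈ xs ] + 0 ≡ + 0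
∑-zero []       = refl
∑-zero (x ∷ xs) = trans (ℤ.+-identityˡ _) (∑-zero xs)

∑-distrib-+ : ∀ (xs : List A) (v w : A → ℤ) → ∑[ x ∈ xs ] (v x + w x) ≡ ∑ xs v + ∑ xs w
∑-distrib-+ []       v w = refl
∑-distrib-+ (x ∷ xs) v w = trans (cong (_+_ (v x + w x)) (∑-distrib-+ xs v w)) (swap (v x) (w x) _ _)
  where
  swap : ∀ a b c d → a + b + (c + d) ≡ a + c + (b + d)
  swap = solve-∀

∑-*ˡ : ∀ (xs : List A) (c : ℤ) (w : A → ℤ) → ∑[ x ∈ xs ] c * w x ≡ c * ∑ xs w
∑-*ˡ []       c w = sym (ℤ.*-zeroʳ c)
∑-*ˡ (x ∷ xs) c w = trans (cong (_+_ (c * w x)) (∑-*ˡ xs c w)) (sym (ℤ.*-distribˡ-+ c (w x) _))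

∑-comm : (xs : List A) (ys : List B) (w : A → B → ℤ) →
         ∑[ x ∈ xs ] ∑[ y ∈ ys ] w x y ≡ ∑[ y ∈ ys ] ∑[ x ∈ xs ] w x y
∑-comm []       ys w = sym (∑-zero ys)
∑-comm (x ∷ xs) ys w = trans (cong (_+_ (∑ ys (w x))) (∑-comm xs ys w)) (sym (∑-distrib-+ ys (w x) _))

∑-map : (f : A → B) (xs : List A) (w : B → ℤ) → ∑ (List.map f xs) w ≡ ∑[ x ∈ xs ] w (f x)
∑-map f []       w = refl
∑-map f (x ∷ xs) w = cong (_+_ (w (f x))) (∑-map f xs w)

∑-concatMap : (f : A → List B) (xs : List A) (w : B → ℤ) →
              ∑ (concatMap f xs) w ≡ ∑[ x ∈ xs ] ∑ (f x) w
∑-concatMap f []       w = refl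
∑-concatMap f (x ∷ xs) w = trans (∑-++ (f x) (concatMap f xs) w) (cong (_+_ (∑ (f x) w)) (∑-concatMap f xs w))

𝟙 : {P : Set} → Dec P → ℤ
𝟙 (yes _) = + 1
𝟙 (no _)  = + 0

𝟙-⇔ : ∀ {P Q : Set} → (P → Q) → (Q → P) → (P? : Dec P) (Q? : Dec Q) → 𝟙 P? ≡ 𝟙 Q?
𝟙-⇔ P→Q Q→P (yes p) (yes q) = refl
𝟙-⇔ P→Q Q→P (yes p) (no ¬q) = ⊥-elim (¬q (P→Q p))
𝟙-⇔ P→Q Q→P (no ¬p) (yes q) = ⊥-elim (¬p (Q→P q))
𝟙-⇔ P→Q Q→P (no ¬p) (no ¬q) = refl

infixl 6 _⊕_ _⊖_
infixr 7 _·_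

_⊕_ _⊖_ : Vec ℤ r → Vec ℤ r → Vec ℤ r
_⊕_ = zipWith _+_
_⊖_ = zipWith _-_

_·_ : ℕ → Vec ℤ r → Vec ℤ r
n · v = map (λ x → + n * x) v

0⃗ : Vec ℤ r
0⃗ = replicate _ (+ 0)

⊕-comm : ∀ (f g : Vec ℤ r) → f ⊕ g ≡ g ⊕ f
⊕-comm f g = Pointwise-≡⇒≡ (zipWith-comm ℤ.+-comm f g)

⊕-assoc : ∀ (f g h : Vec ℤ r) → f ⊕ g ⊕ h ≡ f ⊕ (g ⊕ h)
⊕-assoc f g h = Pointwise-≡⇒≡ (zipWith-assoc ℤ.+-assoc f g h)

⊕-identityˡ : ∀ (f : Vec ℤ r) → 0⃗ ⊕ f ≡ f
⊕-identityˡ f = Pointwise-≡⇒≡ (zipWith-identityˡ ℤ.+-identityˡ f)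

f⊕g⊖f≡g : ∀ (f g : Vec ℤ r) → f ⊕ g ⊖ f ≡ g
f⊕g⊖f≡g []      []      = refl
f⊕g⊖f≡g (x ∷ f) (y ∷ g) = cong₂ _∷_ (lemma x y) (f⊕g⊖f≡g f g)
  where
  lemma : ∀ x y → x + y - x ≡ y
  lemma = solve-∀

f⊕[e⊖f]≡e : ∀ (f e : Vec ℤ r) → f ⊕ (e ⊖ f) ≡ e
f⊕[e⊖f]≡e []      []      = refl
f⊕[e⊖f]≡e (x ∷ f) (y ∷ e) = cong₂ _∷_ (lemma x y) (f⊕[e⊖f]≡e f e)
  where
  lemma : ∀ x y → x + (y - x) ≡ y
  lemma = solve-∀

0·f≡0⃗ : ∀ (f : Vec ℤ r) → 0 · f ≡ 0⃗
0·f≡0⃗ []      = refl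
0·f≡0⃗ (x ∷ f) = cong (+ 0 ∷_) (0·f≡0⃗ f)

f⊕n·f≡[1+n]·f : ∀ n (f : Vec ℤ r) → f ⊕ n · f ≡ suc n · f
f⊕n·f≡[1+n]·f n []      = refl
f⊕n·f≡[1+n]·f n (x ∷ f) = cong₂ _∷_ (lemma (+ n) x) (f⊕n·f≡[1+n]·f n f)
  where
  lemma : ∀ n x → x + n * x ≡ (+ 1 + n) * x
  lemma = solve-∀

-ᵛ_ : Vec ℤ r → Vec ℤ r
-ᵛ v = map -_ v

-ᵛ-involutive : ∀ (v : Vec ℤ r) → -ᵛ -ᵛ v ≡ v
-ᵛ-involutive v = trans (sym (Vec.map-∘ -_ -_ v)) (trans (Vec.map-cong ℤ.neg-involutive v) (Vec.map-id v))

-ᵛ[e⊖p·-ᵛg]≡-ᵛe⊖p·g : ∀ p (e g : Vec ℤ r) → -ᵛ (e ⊖ p · -ᵛ g) ≡ -ᵛ e ⊖ p · g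
-ᵛ[e⊖p·-ᵛg]≡-ᵛe⊖p·g p []      []      = refl
-ᵛ[e⊖p·-ᵛg]≡-ᵛe⊖p·g p (x ∷ e) (y ∷ g) = cong₂ _∷_ (lemma x (+ p) y) (-ᵛ[e⊖p·-ᵛg]≡-ᵛe⊖p·g p e g)
  where
  lemma : ∀ x q y → - (x - q * - y) ≡ - x - q * y
  lemma = solve-∀

δ : Vec ℤ r → Vec ℤ r → ℤ
δ e f = 𝟙 (≡-dec _≟_ f e)

δ-⊕ : ∀ (e f g : Vec ℤ r) → δ e (f ⊕ g) ≡ δ (e ⊖ f) g
δ-⊕ e f g = 𝟙-⇔ (λ { refl → sym (f⊕g⊖f≡g f g) }) (λ { refl → f⊕[e⊖f]≡e f e })
                (≡-dec _≟_ (f ⊕ g) e) (≡-dec _≟_ g (e ⊖ f))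

δ-ᵛ : ∀ (e f : Vec ℤ r) → δ (-ᵛ e) f ≡ δ e (-ᵛ f)
δ-ᵛ e f = 𝟙-⇔ (λ { refl → -ᵛ-involutive e }) (λ { refl → sym (-ᵛ-involutive f) })
              (≡-dec _≟_ f (-ᵛ e)) (≡-dec _≟_ (-ᵛ f) e)

δ-∷ : ∀ x y (e f : Vec ℤ r) → δ (x ∷ e) (y ∷ f) ≡ 𝟙 (y ≟ x) * δ e f
δ-∷ x y e f with y ≟ x | ≡-dec _≟_ f e
... | yes _ | yes _ = refl
... | yes _ | no  _ = refl
... | no  _ | _     = refl

weigh : (Vec ℤ r → ℤ) → Vec ℤ r Product.× ℤ → ℤ
weigh h (e , c) = c * h e

-- Lists with the same coefficients act alike, so the
-- algebra of Laurent polynomials is developed for this action instead of for normal forms of lists.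
⟦_⟧ : LaurentPoly r → (Vec ℤ r → ℤ) → ℤ
⟦ P ⟧ h = ∑ P (weigh h)

coeff≡⟦⟧δ : ∀ (P : LaurentPoly r) e → coeff P e ≡ ⟦ P ⟧ (δ e)
coeff≡⟦⟧δ []            e = refl
coeff≡⟦⟧δ ((f , c) ∷ P) e with ≡-dec _≟_ f e
... | yes _ = cong₂ _+_ (sym (ℤ.*-identityʳ c)) (coeff≡⟦⟧δ P e)
... | no  _ = trans (coeff≡⟦⟧δ P e) (sym (trans (cong (_+ ⟦ P ⟧ (δ e)) (ℤ.*-zeroʳ c)) (ℤ.+-identityˡ _)))

⟦⟧-cong : ∀ (P : LaurentPoly r) {h h′ : Vec ℤ r → ℤ} → (∀ f → h f ≡ h′ f) → ⟦ P ⟧ h ≡ ⟦ P ⟧ h′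
⟦⟧-cong P h≗h′ = ∑-cong P (λ { (f , c) → cong (c *_) (h≗h′ f) })

⟦⟧-++ : ∀ (P Q : LaurentPoly r) h → ⟦ P ++ Q ⟧ h ≡ ⟦ P ⟧ h + ⟦ Q ⟧ h
⟦⟧-++ P Q h = ∑-++ P Q (weigh h)

⟦⟧-zero : ∀ (P : LaurentPoly r) → ⟦ P ⟧ (λ _ → + 0) ≡ + 0
⟦⟧-zero P = trans (∑-cong P (λ { (f , c) → ℤ.*-zeroʳ c })) (∑-zero P)

private
  x*[y*z]≡y*[x*z] : ∀ x y z → x * (y * z) ≡ y * (x * z)
  x*[y*z]≡y*[x*z] = solve-∀

⟦⟧-*ˡ : ∀ (P : LaurentPoly r) c h → ⟦ P ⟧ (λ f → c * h f) ≡ c * ⟦ P ⟧ h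
⟦⟧-*ˡ P c h = trans (∑-cong P (λ { (f , d) → x*[y*z]≡y*[x*z] d c (h f) })) (∑-*ˡ P c (weigh h))

∑-⟦⟧-comm : ∀ (xs : List A) (Q : LaurentPoly r) (H : A → Vec ℤ r → ℤ) →
            ∑[ x ∈ xs ] ⟦ Q ⟧ (H x) ≡ ⟦ Q ⟧ (λ g → ∑[ x ∈ xs ] H x g)
∑-⟦⟧-comm xs Q H = begin
  ∑[ x ∈ xs ] ∑[ (g , d) ∈ Q ] d * H x g   ≡⟨ ∑-comm xs Q (λ { x (g , d) → d * H x g }) ⟩
  ∑[ (g , d) ∈ Q ] ∑[ x ∈ xs ] d * H x g   ≡⟨ ∑-cong Q (λ { (g , d) → ∑-*ˡ xs d (λ x → H x g) }) ⟩
  ∑[ (g , d) ∈ Q ] d * (∑[ x ∈ xs ] H x g) ∎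
  where open ≡-Reasoning

⟦⟧-comm : ∀ (P Q : LaurentPoly r) (h : Vec ℤ r → Vec ℤ r → ℤ) →
          ⟦ P ⟧ (λ f → ⟦ Q ⟧ (h f)) ≡ ⟦ Q ⟧ (λ g → ⟦ P ⟧ (λ f → h f g))
⟦⟧-comm P Q h = trans (∑-cong P (λ { (f , c) → sym (⟦⟧-*ˡ Q c (h f)) }))
                      (∑-⟦⟧-comm P Q (λ { (f , c) g → c * h f g }))

⟦⟧-mul : ∀ (P Q : LaurentPoly r) h → ⟦ mul P Q ⟧ h ≡ ⟦ P ⟧ (λ f → ⟦ Q ⟧ (λ g → h (f ⊕ g)))
⟦⟧-mul []            Q h = refl
⟦⟧-mul ((f , c) ∷ P) Q h = trans (⟦⟧-++ scaled (mul P Q) h) (cong₂ _+_ head (⟦⟧-mul P Q h))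
  where
  scaled = List.map (λ { (g , d) → (f ⊕ g , c * d) }) Q
  head : ⟦ scaled ⟧ h ≡ c * ⟦ Q ⟧ (λ g → h (f ⊕ g))
  head = trans (∑-map _ Q (weigh h))
        (trans (∑-cong Q (λ { (g , d) → ℤ.*-assoc c d (h (f ⊕ g)) })) (∑-*ˡ Q c (weigh (λ g → h (f ⊕ g)))))

⟦⟧-one : ∀ (h : Vec ℤ r → ℤ) → ⟦ one ⟧ h ≡ h 0⃗
⟦⟧-one h = trans (ℤ.+-identityʳ _) (ℤ.*-identityˡ _)

coeff-mul : ∀ (P Q : LaurentPoly r) e → coeff (mul P Q) e ≡ ⟦ P ⟧ (λ f → coeff Q (e ⊖ f))
coeff-mul P Q e = begin
  coeff (mul P Q) e                          ≡⟨ coeff≡⟦⟧δ (mul P Q) e ⟩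
  ⟦ mul P Q ⟧ (δ e)                          ≡⟨ ⟦⟧-mul P Q (δ e) ⟩
  ⟦ P ⟧ (λ f → ⟦ Q ⟧ (λ g → δ e (f ⊕ g)))    ≡⟨ ⟦⟧-cong P (λ f → ⟦⟧-cong Q (δ-⊕ e f)) ⟩
  ⟦ P ⟧ (λ f → ⟦ Q ⟧ (δ (e ⊖ f)))            ≡⟨ ⟦⟧-cong P (λ f → coeff≡⟦⟧δ Q (e ⊖ f)) ⟨
  ⟦ P ⟧ (λ f → coeff Q (e ⊖ f))              ∎
  where open ≡-Reasoning

infix 4 _≐_
_≐_ : LaurentPoly r → LaurentPoly r → Set
P ≐ Q = ∀ h → ⟦ P ⟧ h ≡ ⟦ Q ⟧ h

++-comm-≐ : ∀ (P Q : LaurentPoly r) → P ++ Q ≐ Q ++ P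
++-comm-≐ P Q h = trans (⟦⟧-++ P Q h) (trans (ℤ.+-comm (⟦ P ⟧ h) _) (sym (⟦⟧-++ Q P h)))

++-assoc-≐ : ∀ (P Q R : LaurentPoly r) → (P ++ Q) ++ R ≐ P ++ (Q ++ R)
++-assoc-≐ P Q R h = cong (λ X → ⟦ X ⟧ h) (List.++-assoc P Q R)

mul-comm-≐ : ∀ (P Q : LaurentPoly r) → mul P Q ≐ mul Q P
mul-comm-≐ P Q h = begin
  ⟦ mul P Q ⟧ h                          ≡⟨ ⟦⟧-mul P Q h ⟩
  ⟦ P ⟧ (λ f → ⟦ Q ⟧ (λ g → h (f ⊕ g)))  ≡⟨ ⟦⟧-comm P Q (λ f g → h (f ⊕ g)) ⟩
  ⟦ Q ⟧ (λ g → ⟦ P ⟧ (λ f → h (f ⊕ g)))  ≡⟨ ⟦⟧-cong Q (λ g → ⟦⟧-cong P (λ f → cong h (⊕-comm f g))) ⟩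
  ⟦ Q ⟧ (λ g → ⟦ P ⟧ (λ f → h (g ⊕ f)))  ≡⟨ ⟦⟧-mul Q P h ⟨
  ⟦ mul Q P ⟧ h                          ∎
  where open ≡-Reasoning

mul-assoc-≐ : ∀ (P Q R : LaurentPoly r) → mul (mul P Q) R ≐ mul P (mul Q R)
mul-assoc-≐ P Q R h = begin
  ⟦ mul (mul P Q) R ⟧ h
    ≡⟨ ⟦⟧-mul (mul P Q) R h ⟩
  ⟦ mul P Q ⟧ (λ e → ⟦ R ⟧ (λ g → h (e ⊕ g)))
    ≡⟨ ⟦⟧-mul P Q _ ⟩
  ⟦ P ⟧ (λ f → ⟦ Q ⟧ (λ g → ⟦ R ⟧ (λ k → h (f ⊕ g ⊕ k))))
    ≡⟨ ⟦⟧-cong P (λ f → ⟦⟧-cong Q (λ g → ⟦⟧-cong R (λ k → cong h (⊕-assoc f g k)))) ⟩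
  ⟦ P ⟧ (λ f → ⟦ Q ⟧ (λ g → ⟦ R ⟧ (λ k → h (f ⊕ (g ⊕ k)))))
    ≡⟨ ⟦⟧-cong P (λ f → ⟦⟧-mul Q R (λ e → h (f ⊕ e))) ⟨
  ⟦ P ⟧ (λ f → ⟦ mul Q R ⟧ (λ e → h (f ⊕ e)))
    ≡⟨ ⟦⟧-mul P (mul Q R) h ⟨
  ⟦ mul P (mul Q R) ⟧ h ∎
  where open ≡-Reasoning

mul-identityˡ-≐ : ∀ (P : LaurentPoly r) → mul one P ≐ P
mul-identityˡ-≐ P h = trans (⟦⟧-mul one P h)
  (trans (⟦⟧-one (λ f → ⟦ P ⟧ (λ g → h (f ⊕ g)))) (⟦⟧-cong P (λ g → cong h (⊕-identityˡ g))))

mul-distribʳ-≐ : ∀ (P Q R : LaurentPoly r) → mul (Q ++ R) P ≐ mul Q P ++ mul R P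
mul-distribʳ-≐ P Q R h = begin
  ⟦ mul (Q ++ R) P ⟧ h
    ≡⟨ ⟦⟧-mul (Q ++ R) P h ⟩
  ⟦ Q ++ R ⟧ (λ f → ⟦ P ⟧ (λ g → h (f ⊕ g)))
    ≡⟨ ⟦⟧-++ Q R _ ⟩
  ⟦ Q ⟧ (λ f → ⟦ P ⟧ (λ g → h (f ⊕ g))) + ⟦ R ⟧ (λ f → ⟦ P ⟧ (λ g → h (f ⊕ g)))
    ≡⟨ cong₂ _+_ (⟦⟧-mul Q P h) (⟦⟧-mul R P h) ⟨
  ⟦ mul Q P ⟧ h + ⟦ mul R P ⟧ h
    ≡⟨ ⟦⟧-++ (mul Q P) (mul R P) h ⟨
  ⟦ mul Q P ++ mul R P ⟧ h ∎
  where open ≡-Reasoning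

remove : Vec ℤ r → LaurentPoly r → LaurentPoly r
remove g []            = []
remove g ((f , c) ∷ P) with ≡-dec _≟_ f g
... | yes _ = remove g P
... | no  _ = (f , c) ∷ remove g P

remove-head : ∀ (g : Vec ℤ r) c P → remove g ((g , c) ∷ P) ≡ remove g P
remove-head g c P with ≡-dec _≟_ g g
... | yes _   = refl
... | no  g≢g = contradiction refl g≢g

length-remove : ∀ (g : Vec ℤ r) P → List.length (remove g P) ≤ List.length P
length-remove g []            = z≤n
length-remove g ((f , c) ∷ P) with ≡-dec _≟_ f g
... | yes _ = ℕ.m≤n⇒m≤1+n (length-remove g P)
... | no  _ = s≤s (length-remove g P)

coeff-remove-≡ : ∀ (g : Vec ℤ r) P → coeff (remove g P) g ≡ + 0
coeff-remove-≡ g []            = refl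
coeff-remove-≡ g ((f , c) ∷ P) with ≡-dec _≟_ f g
... | yes _   = coeff-remove-≡ g P
... | no  f≢g with ≡-dec _≟_ f g
...   | yes f≡g = contradiction f≡g f≢g
...   | no  _   = coeff-remove-≡ g P

coeff-remove-≢ : ∀ {g e : Vec ℤ r} P → e ≢ g → coeff (remove g P) e ≡ coeff P e
coeff-remove-≢ []                    e≢g = refl
coeff-remove-≢ {g = g} {e} ((f , c) ∷ P) e≢g with ≡-dec _≟_ f g
... | yes refl with ≡-dec _≟_ f e
...   | yes refl = contradiction refl e≢g
...   | no  _    = coeff-remove-≢ P e≢g
coeff-remove-≢ {g = g} {e} ((f , c) ∷ P) e≢g | no _ with ≡-dec _≟_ f e
...   | yes _ = cong (_+_ c) (coeff-remove-≢ P e≢g)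
...   | no  _ = coeff-remove-≢ P e≢g

⟦⟧-remove : ∀ (P : LaurentPoly r) g h → ⟦ P ⟧ h ≡ coeff P g * h g + ⟦ remove g P ⟧ h
⟦⟧-remove []            g h = sym (ℤ.*-zeroˡ (h g))
⟦⟧-remove ((f , c) ∷ P) g h with ≡-dec _≟_ f g
... | yes refl = trans (cong (_+_ (c * h f)) (⟦⟧-remove P f h)) (regroup c (coeff P f) (h f) _)
  where
  regroup : ∀ c a x y → c * x + (a * x + y) ≡ (c + a) * x + y
  regroup = solve-∀
... | no  _    = trans (cong (_+_ (c * h f)) (⟦⟧-remove P g h)) (swap (c * h f) (coeff P g * h g) _)
  where
  swap : ∀ a b y → a + (b + y) ≡ b + (a + y)
  swap = solve-∀

-- DegLE only constrains exponents with nonzero coefficient, while a list may carry cancelling terms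
-- anywhere else; hence h and h′ need only agree on the support.
⟦⟧-cong-support : ∀ (P : LaurentPoly r) {h h′ : Vec ℤ r → ℤ} →
                  (∀ f → coeff P f ≢ + 0 → h f ≡ h′ f) → ⟦ P ⟧ h ≡ ⟦ P ⟧ h′
⟦⟧-cong-support P = go (List.length P) P ℕ.≤-refl
  where
  go : ∀ n (P : LaurentPoly _) {h h′} → List.length P ≤ n →
       (∀ f → coeff P f ≢ + 0 → h f ≡ h′ f) → ⟦ P ⟧ h ≡ ⟦ P ⟧ h′
  go _       []            _         _     = refl
  go (suc n) ((g , c) ∷ P) {h} {h′} (s≤s |P|≤n) agree = begin
    ⟦ Q ⟧ h                               ≡⟨ ⟦⟧-remove Q g h ⟩
    coeff Q g * h g + ⟦ remove g Q ⟧ h    ≡⟨ cong₂ _+_ at-g (go n (remove g Q) |Q-g|≤n agree-off-g) ⟩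
    coeff Q g * h′ g + ⟦ remove g Q ⟧ h′  ≡⟨ ⟦⟧-remove Q g h′ ⟨
    ⟦ Q ⟧ h′                              ∎
    where
    open ≡-Reasoning
    Q = (g , c) ∷ P
    at-g : coeff Q g * h g ≡ coeff Q g * h′ g
    at-g with coeff Q g ≟ + 0
    ... | yes Qg≡0 = trans (cong (_* h g) Qg≡0) (sym (cong (_* h′ g) Qg≡0))
    ... | no  Qg≢0 = cong (coeff Q g *_) (agree g Qg≢0)
    |Q-g|≤n : List.length (remove g Q) ≤ n
    |Q-g|≤n = subst (λ X → List.length X ≤ n) (sym (remove-head g c P)) (ℕ.≤-trans (length-remove g P) |P|≤n)
    agree-off-g : ∀ f → coeff (remove g Q) f ≢ + 0 → h f ≡ h′ f
    agree-off-g f Q-g[f]≢0 with ≡-dec _≟_ f g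
    ... | yes refl = contradiction (coeff-remove-≡ g Q) Q-g[f]≢0
    ... | no  f≢g  = agree f (λ Qf≡0 → Q-g[f]≢0 (trans (coeff-remove-≢ Q f≢g) Qf≡0))

private
  x-y+y≡x : ∀ x y → x - y + y ≡ x
  x-y+y≡x = solve-∀

∣x∣≤∣x-y∣+∣y∣ : ∀ x y → ∣ x ∣ ≤ ∣ x - y ∣ ℕ.+ ∣ y ∣
∣x∣≤∣x-y∣+∣y∣ x y =
  subst (λ z → ∣ z ∣ ≤ ∣ x - y ∣ ℕ.+ ∣ y ∣) (x-y+y≡x x y) (ℤ.∣i+j∣≤∣i∣+∣j∣ (x - y) y)

<∣x-y∣ : ∀ {B K} x y → ∣ y ∣ ≤ B → B ℕ.+ K < ∣ x ∣ → K < ∣ x - y ∣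
<∣x-y∣ {B} {K} x y ∣y∣≤B B+K<∣x∣ = ℕ.+-cancelˡ-< B K ∣ x - y ∣ (begin-strict
  B ℕ.+ K               <⟨ B+K<∣x∣ ⟩
  ∣ x ∣                 ≤⟨ ∣x∣≤∣x-y∣+∣y∣ x y ⟩
  ∣ x - y ∣ ℕ.+ ∣ y ∣   ≤⟨ ℕ.+-monoʳ-≤ ∣ x - y ∣ ∣y∣≤B ⟩
  ∣ x - y ∣ ℕ.+ B       ≡⟨ ℕ.+-comm ∣ x - y ∣ B ⟩
  B ℕ.+ ∣ x - y ∣       ∎)
  where open ℕ.≤-Reasoning

Outside : ℕ → Vec ℤ r → Set
Outside K = Any (λ x → K < ∣ x ∣)

Inside : ℕ → Vec ℤ r → Set
Inside K = All (λ x → ∣ x ∣ ≤ K)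

Outside-ᵛ : ∀ {K} (v : Vec ℤ r) → Outside K v → Outside K (-ᵛ v)
Outside-ᵛ (x ∷ v) (here K<∣x∣) = here (subst (_ <_) (sym (ℤ.∣-i∣≡∣i∣ x)) K<∣x∣)
Outside-ᵛ (x ∷ v) (there out)  = there (Outside-ᵛ v out)

Outside-⊖ : ∀ {B K} (e f : Vec ℤ r) → Inside B f → Outside (B ℕ.+ K) e → Outside K (e ⊖ f)
Outside-⊖ (x ∷ e) (y ∷ f) (∣y∣≤B ∷ _) (here B+K<∣x∣) = here (<∣x-y∣ x y ∣y∣≤B B+K<∣x∣)
Outside-⊖ (x ∷ e) (y ∷ f) (_ ∷ f≤B)   (there out)    = there (Outside-⊖ e f f≤B out)

¬Outside-0⃗ : ∀ K → ¬ Outside {r} K 0⃗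
¬Outside-0⃗ K (here ())
¬Outside-0⃗ K (there out) = ¬Outside-0⃗ K out

coeff-pow-Outside : ∀ {P : LaurentPoly r} {D} → DegLE P (+ D) → ∀ k e → Outside (k ℕ.* D) e → coeff (pow P k) e ≡ + 0
coeff-pow-Outside degP zero e out with ≡-dec _≟_ 0⃗ e
... | yes refl = contradiction out (¬Outside-0⃗ 0)
... | no  _    = refl
coeff-pow-Outside {P = P} degP (suc k) e out = begin
  coeff (mul P (pow P k)) e             ≡⟨ coeff-mul P (pow P k) e ⟩
  ⟦ P ⟧ (λ f → coeff (pow P k) (e ⊖ f)) ≡⟨ ⟦⟧-cong-support P vanishes ⟩
  ⟦ P ⟧ (λ _ → + 0)                     ≡⟨ ⟦⟧-zero P ⟩
  + 0                                   ∎
  where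
  open ≡-Reasoning
  vanishes : ∀ f → coeff P f ≢ + 0 → coeff (pow P k) (e ⊖ f) ≡ + 0
  vanishes f Pf≢0 = coeff-pow-Outside degP k (e ⊖ f) (Outside-⊖ e f (All.map ℤ.drop‿+≤+ (degP f Pf≢0)) out)

module Modulo (p : ℕ) where

  -- This congruence and _≈ₚ_ below are records, so that the related terms can be inferred from the type.
  infix 4 _≋_
  record _≋_ (x y : ℤ) : Set where
    constructor mod
    field ≡[mod] : x ≡ y [mod p ]
  open _≋_ public

  private
    via : ∀ {a x y} → a ≡ x - y → (+ p) ℤ.∣ a → x ≋ y
    via refl p∣a = mod (ℤ.∣⇒∣ᵤ p∣a)

    divides : ∀ {x y} → x ≋ y → (+ p) ℤ.∣ (x - y)
    divides (mod p∣x-y) = ℤ.∣ᵤ⇒∣ p∣x-y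

  ≡⇒≋ : ∀ {x y} → x ≡ y → x ≋ y
  ≡⇒≋ {x} refl = via (sym (ℤ.+-inverseʳ x)) (ℤ.divides (+ 0) refl)

  ≋-sym : ∀ {x y} → x ≋ y → y ≋ x
  ≋-sym {x} {y} x≋y = via (lemma x y) (ℤ.∣m⇒∣-m (divides x≋y))
    where
    lemma : ∀ x y → - (x - y) ≡ y - x
    lemma = solve-∀

  ≋-trans : ∀ {x y z} → x ≋ y → y ≋ z → x ≋ z
  ≋-trans {x} {y} {z} x≋y y≋z = via (lemma x y z) (ℤ.∣m∣n⇒∣m+n (divides x≋y) (divides y≋z))
    where
    lemma : ∀ x y z → x - y + (y - z) ≡ x - z
    lemma = solve-∀

  +-cong : ∀ {x y u v} → x ≋ y → u ≋ v → x + u ≋ y + v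
  +-cong {x} {y} {u} {v} x≋y u≋v = via (lemma x y u v) (ℤ.∣m∣n⇒∣m+n (divides x≋y) (divides u≋v))
    where
    lemma : ∀ x y u v → x - y + (u - v) ≡ x + u - (y + v)
    lemma = solve-∀

  *-congˡ : ∀ c {x y} → x ≋ y → c * x ≋ c * y
  *-congˡ c {x} {y} x≋y = via (lemma c x y) (ℤ.∣n⇒∣m*n c (divides x≋y))
    where
    lemma : ∀ c x y → c * (x - y) ≡ c * x - c * y
    lemma = solve-∀

  *-congʳ : ∀ c {x y} → x ≋ y → x * c ≋ y * c
  *-congʳ c {x} {y} x≋y = subst₂ _≋_ (ℤ.*-comm c x) (ℤ.*-comm c y) (*-congˡ c x≋y)

  p*x≋0 : ∀ x → + p * x ≋ + 0
  p*x≋0 x = via (sym (ℤ.+-identityʳ (+ p * x))) (ℤ.divides x (ℤ.*-comm (+ p) x))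

  x≋x%p : ∀ x .{{_ : ℕ.NonZero p}} → x ≋ + (x %ℕ p)
  x≋x%p x = via (lemma (a≡a%ℕn+[a/ℕn]*n x p)) (ℤ.divides (x /ℕ p) refl)
    where
    cancel : ∀ r m → m ≡ r + m - r
    cancel = solve-∀
    lemma : x ≡ + (x %ℕ p) + x /ℕ p * + p → x /ℕ p * + p ≡ x - + (x %ℕ p)
    lemma eq = trans (cancel (+ (x %ℕ p)) _) (cong (_- + (x %ℕ p)) (sym eq))

  ∑-≋ : ∀ (xs : List A) {v w : A → ℤ} → (∀ x → v x ≋ w x) → ∑ xs v ≋ ∑ xs w
  ∑-≋ []       v≋w = ≡⇒≋ refl
  ∑-≋ (x ∷ xs) v≋w = +-cong (v≋w x) (∑-≋ xs v≋w)

  ⟦⟧-≋ : ∀ (P : LaurentPoly r) {h h′ : Vec ℤ r → ℤ} → (∀ f → h f ≋ h′ f) → ⟦ P ⟧ h ≋ ⟦ P ⟧ h′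
  ⟦⟧-≋ P h≋h′ = ∑-≋ P (λ { (f , c) → *-congˡ c (h≋h′ f) })

  infix 4 _≈ₚ_
  record _≈ₚ_ {r} (P Q : LaurentPoly r) : Set where
    constructor pointwise
    field ⟦⟧-≋ₚ : ∀ h → ⟦ P ⟧ h ≋ ⟦ Q ⟧ h
  open _≈ₚ_ public

  ≐⇒≈ₚ : ∀ {P Q : LaurentPoly r} → P ≐ Q → P ≈ₚ Q
  ≐⇒≈ₚ P≐Q = pointwise (λ h → ≡⇒≋ (P≐Q h))

  ≈ₚ-isEquivalence : IsEquivalence (_≈ₚ_ {r})
  ≈ₚ-isEquivalence = record
    { refl  = pointwise (λ h → ≡⇒≋ refl)
    ; sym   = λ P≈Q → pointwise (λ h → ≋-sym (⟦⟧-≋ₚ P≈Q h))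
    ; trans = λ P≈Q Q≈R → pointwise (λ h → ≋-trans (⟦⟧-≋ₚ P≈Q h) (⟦⟧-≋ₚ Q≈R h))
    }

  coeff-≈ₚ : ∀ {P Q : LaurentPoly r} → P ≈ₚ Q → ∀ e → coeff P e ≋ coeff Q e
  coeff-≈ₚ {P = P} {Q} P≈Q e = subst₂ _≋_ (sym (coeff≡⟦⟧δ P e)) (sym (coeff≡⟦⟧δ Q e)) (⟦⟧-≋ₚ P≈Q (δ e))

  ++-congₚ : ∀ {P P′ Q Q′ : LaurentPoly r} → P ≈ₚ P′ → Q ≈ₚ Q′ → P ++ Q ≈ₚ P′ ++ Q′
  ++-congₚ {P = P} {P′} {Q} {Q′} P≈P′ Q≈Q′ = pointwise λ h →
    subst₂ _≋_ (sym (⟦⟧-++ P Q h)) (sym (⟦⟧-++ P′ Q′ h)) (+-cong (⟦⟧-≋ₚ P≈P′ h) (⟦⟧-≋ₚ Q≈Q′ h))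

  mul-congₚ : ∀ {P P′ Q Q′ : LaurentPoly r} → P ≈ₚ P′ → Q ≈ₚ Q′ → mul P Q ≈ₚ mul P′ Q′
  mul-congₚ {P = P} {P′} {Q} {Q′} P≈P′ Q≈Q′ = pointwise λ h →
    subst₂ _≋_ (sym (⟦⟧-mul P Q h)) (sym (⟦⟧-mul P′ Q′ h))
      (≋-trans (⟦⟧-≋ₚ P≈P′ _) (⟦⟧-≋ P′ (λ f → ⟦⟧-≋ₚ Q≈Q′ (λ g → h (f ⊕ g)))))

  semiring : ℕ → CommutativeSemiring 0ℓ 0ℓ
  semiring r = record
    { Carrier               = LaurentPoly r
    ; _≈_                   = _≈ₚ_
    ; _+_                   = _++_
    ; _*_                   = mul
    ; 0#                    = []
    ; 1#                    = one
    ; isCommutativeSemiring = isCommutativeSemiringˡ record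
      { +-isCommutativeMonoid = isCommutativeMonoidˡ record
        { isSemigroup = record
          { isMagma = record { isEquivalence = ≈ₚ-isEquivalence ; ∙-cong = ++-congₚ }
          ; assoc   = λ P Q R → ≐⇒≈ₚ (++-assoc-≐ P Q R)
          }
        ; identityˡ = λ P → IsEquivalence.refl ≈ₚ-isEquivalence
        ; comm      = λ P Q → ≐⇒≈ₚ (++-comm-≐ P Q)
        }
      ; *-isCommutativeMonoid = isCommutativeMonoidˡ record
        { isSemigroup = record
          { isMagma = record { isEquivalence = ≈ₚ-isEquivalence ; ∙-cong = mul-congₚ }
          ; assoc   = λ P Q R → ≐⇒≈ₚ (mul-assoc-≐ P Q R)
          }
        ; identityˡ = λ P → ≐⇒≈ₚ (mul-identityˡ-≐ P)
        ; comm      = λ P Q → ≐⇒≈ₚ (mul-comm-≐ P Q)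
        }
      ; distribʳ = λ P Q R → ≐⇒≈ₚ (mul-distribʳ-≐ P Q R)
      ; zeroˡ    = λ P → IsEquivalence.refl ≈ₚ-isEquivalence
      }
    }

module FrobeniusLaurent {p} (p-prime : Prime p) {r : ℕ} where

  open Modulo p
  module Sₚ = CommutativeSemiring (semiring r)
  open Frobenius (semiring r)
  open import Algebra.Properties.Semiring.Mult (CommutativeSemiring.semiring (semiring r)) using (_×_; ×-congʳ)
  open import Algebra.Properties.Semiring.Exp (CommutativeSemiring.semiring (semiring r)) using (_^_; ^-homo-*; ^-assocʳ; ^-congˡ)
  import Relation.Binary.Reasoning.Setoid Sₚ.setoid as ≈ₚ-Reasoning

  pow≡^ : ∀ (P : LaurentPoly r) n → pow P n ≡ P ^ n
  pow≡^ P zero    = refl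
  pow≡^ P (suc n) = cong (mul P) (pow≡^ P n)

  ⟦⟧-× : ∀ n (P : LaurentPoly r) h → ⟦ n × P ⟧ h ≡ + n * ⟦ P ⟧ h
  ⟦⟧-× zero    P h = refl
  ⟦⟧-× (suc n) P h = begin
    ⟦ P ++ n × P ⟧ h          ≡⟨ ⟦⟧-++ P (n × P) h ⟩
    ⟦ P ⟧ h + ⟦ n × P ⟧ h     ≡⟨ cong (_+_ (⟦ P ⟧ h)) (⟦⟧-× n P h) ⟩
    ⟦ P ⟧ h + + n * ⟦ P ⟧ h   ≡⟨ cong (_+ + n * ⟦ P ⟧ h) (ℤ.*-identityˡ (⟦ P ⟧ h)) ⟨
    + 1 * ⟦ P ⟧ h + + n * ⟦ P ⟧ h ≡⟨ ℤ.*-distribʳ-+ (⟦ P ⟧ h) (+ 1) (+ n) ⟨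
    + suc n * ⟦ P ⟧ h         ∎
    where open ≡-Reasoning

  p×P≈ₚ[] : ∀ (P : LaurentPoly r) → p × P ≈ₚ []
  p×P≈ₚ[] P = pointwise (λ h → ≋-trans (≡⇒≋ (⟦⟧-× p P h)) (p*x≋0 (⟦ P ⟧ h)))

  monomial : Vec ℤ r → ℤ → LaurentPoly r
  monomial f c = (f , c) ∷ []

  ⟦⟧-monomial : ∀ f c h → ⟦ monomial f c ⟧ h ≡ c * h f
  ⟦⟧-monomial f c h = ℤ.+-identityʳ (c * h f)

  monomial-≋ : ∀ f {c d} → c ≋ d → monomial f c ≈ₚ monomial f d
  monomial-≋ f {c} {d} c≋d = pointwise λ h →
    subst₂ _≋_ (sym (⟦⟧-monomial f c h)) (sym (⟦⟧-monomial f d h)) (*-congʳ (h f) c≋d)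

  n×monomial : ∀ n f → n × monomial f (+ 1) ≐ monomial f (+ n)
  n×monomial n f h = begin
    ⟦ n × monomial f (+ 1) ⟧ h      ≡⟨ ⟦⟧-× n (monomial f (+ 1)) h ⟩
    + n * ⟦ monomial f (+ 1) ⟧ h    ≡⟨ cong (+ n *_) (trans (⟦⟧-monomial f (+ 1) h) (ℤ.*-identityˡ (h f))) ⟩
    + n * h f                       ≡⟨ ⟦⟧-monomial f (+ n) h ⟨
    ⟦ monomial f (+ n) ⟧ h          ∎
    where open ≡-Reasoning

  pow-monomial : ∀ f n → pow (monomial f (+ 1)) n ≐ monomial (n · f) (+ 1)
  pow-monomial f zero    h = cong (λ e → + 1 * h e + + 0) (sym (0·f≡0⃗ f))
  pow-monomial f (suc n) h = begin
    ⟦ mul (monomial f (+ 1)) (pow (monomial f (+ 1)) n) ⟧ h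
      ≡⟨ ⟦⟧-mul (monomial f (+ 1)) (pow (monomial f (+ 1)) n) h ⟩
    ⟦ monomial f (+ 1) ⟧ (λ e → ⟦ pow (monomial f (+ 1)) n ⟧ (λ g → h (e ⊕ g)))
      ≡⟨ trans (⟦⟧-monomial f (+ 1) (λ e → ⟦ pow (monomial f (+ 1)) n ⟧ (λ g → h (e ⊕ g)))) (ℤ.*-identityˡ _) ⟩
    ⟦ pow (monomial f (+ 1)) n ⟧ (λ g → h (f ⊕ g))
      ≡⟨ pow-monomial f n (λ g → h (f ⊕ g)) ⟩
    ⟦ monomial (n · f) (+ 1) ⟧ (λ g → h (f ⊕ g))
      ≡⟨ ⟦⟧-monomial (n · f) (+ 1) (λ g → h (f ⊕ g)) ⟩
    + 1 * h (f ⊕ n · f)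
      ≡⟨ cong (λ e → + 1 * h e) (f⊕n·f≡[1+n]·f n f) ⟩
    + 1 * h (suc n · f)
      ≡⟨ ⟦⟧-monomial (suc n · f) (+ 1) h ⟨
    ⟦ monomial (suc n · f) (+ 1) ⟧ h ∎
    where open ≡-Reasoning

  -- Reducing c to its residue m makes the monomial m copies of x^f, to which the Frobenius applies termwise.
  monomial^p : ∀ f c → monomial f c ^ p ≈ₚ monomial (p · f) c
  monomial^p f c = begin
    monomial f c ^ p                 ≈⟨ ^-congˡ p (monomial-≋ f c≋m) ⟩
    monomial f (+ m) ^ p             ≈⟨ ^-congˡ p (≐⇒≈ₚ (λ h → sym (n×monomial m f h))) ⟩
    (m × monomial f (+ 1)) ^ p       ≈⟨ [n×x]^p≈n×x^p p-prime p×P≈ₚ[] m (monomial f (+ 1)) ⟩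
    m × monomial f (+ 1) ^ p         ≡⟨ cong (m ×_) (pow≡^ (monomial f (+ 1)) p) ⟨
    m × pow (monomial f (+ 1)) p     ≈⟨ ×-congʳ m (≐⇒≈ₚ (pow-monomial f p)) ⟩
    m × monomial (p · f) (+ 1)       ≈⟨ ≐⇒≈ₚ (n×monomial m (p · f)) ⟩
    monomial (p · f) (+ m)           ≈⟨ monomial-≋ (p · f) c≋m ⟨
    monomial (p · f) c               ∎
    where
    open ≈ₚ-Reasoning
    instance _ = prime⇒nonZero p-prime
    m = c %ℕ p
    c≋m : c ≋ + m
    c≋m = x≋x%p c

  frob : LaurentPoly r → LaurentPoly r
  frob Q = List.map (λ { (f , c) → (p · f , c) }) Q

  frobenius : ∀ (Q : LaurentPoly r) → Q ^ p ≈ₚ frob Q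
  frobenius []            = 0#^p≈0# p-prime
  frobenius ((f , c) ∷ Q) = Sₚ.trans (freshman's-dream p-prime p×P≈ₚ[] (monomial f c) Q)
                                     (++-congₚ (monomial^p f c) (frobenius Q))

  pow-p*n+k : ∀ (P : LaurentPoly r) n k → pow P (p ℕ.* n ℕ.+ k) ≈ₚ mul (frob (pow P n)) (pow P k)
  pow-p*n+k P n k = begin
    pow P (p ℕ.* n ℕ.+ k)            ≡⟨ pow≡^ P (p ℕ.* n ℕ.+ k) ⟩
    P ^ (p ℕ.* n ℕ.+ k)              ≈⟨ ^-homo-* P (p ℕ.* n) k ⟩
    mul (P ^ (p ℕ.* n)) (P ^ k)      ≡⟨ cong (λ e → mul (P ^ e) (P ^ k)) (ℕ.*-comm p n) ⟩
    mul (P ^ (n ℕ.* p)) (P ^ k)      ≈⟨ Sₚ.*-congʳ (^-assocʳ P n p) ⟨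
    mul ((P ^ n) ^ p) (P ^ k)        ≈⟨ Sₚ.*-congʳ (frobenius (P ^ n)) ⟩
    mul (frob (P ^ n)) (P ^ k)       ≡⟨ cong₂ (λ X Y → mul (frob X) Y) (pow≡^ P n) (pow≡^ P k) ⟨
    mul (frob (pow P n)) (pow P k)   ∎
    where open ≈ₚ-Reasoning

  coeff-mul-frob : ∀ (Q R : LaurentPoly r) e → coeff (mul (frob Q) R) e ≡ ⟦ Q ⟧ (λ g → coeff R (e ⊖ p · g))
  coeff-mul-frob Q R e = trans (coeff-mul (frob Q) R e) (∑-map _ Q (weigh (λ f → coeff R (e ⊖ f))))

  V-p*n+k : ∀ (P : LaurentPoly r) n k i → V P (p ℕ.* n ℕ.+ k) i ≋ ⟦ pow P n ⟧ (λ g → coeff (pow P k) (-ᵛ i ⊖ p · g))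
  V-p*n+k P n k i = subst (V P (p ℕ.* n ℕ.+ k) i ≋_) (coeff-mul-frob (pow P n) (pow P k) (-ᵛ i))
                          (coeff-≈ₚ (pow-p*n+k P n k) (-ᵛ i))

∑-𝟙-∉ : ∀ {y} xs (w : ℤ → ℤ) → y ∉ xs → ∑[ x ∈ xs ] 𝟙 (y ≟ x) * w x ≡ + 0
∑-𝟙-∉         []       w y∉xs = refl
∑-𝟙-∉ {y = y} (x ∷ xs) w y∉xs with y ≟ x
... | yes refl = contradiction (Anyₗ.here refl) y∉xs
... | no  _    = trans (ℤ.+-identityˡ _) (∑-𝟙-∉ xs w (λ y∈xs → y∉xs (Anyₗ.there y∈xs)))

∑-𝟙-∈ : ∀ {y xs} (w : ℤ → ℤ) → Unique xs → y ∈ xs → ∑[ x ∈ xs ] 𝟙 (y ≟ x) * w x ≡ w y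
∑-𝟙-∈ {y} {x ∷ xs} w (x∉xs ∷ _) (Anyₗ.here refl) with x ≟ x
... | yes _   = trans (cong₂ _+_ (ℤ.*-identityˡ (w x)) (∑-𝟙-∉ xs w (All¬⇒¬Any x∉xs))) (ℤ.+-identityʳ (w x))
... | no  x≢x = contradiction refl x≢x
∑-𝟙-∈ {y} {x ∷ xs} w (x∉xs ∷ xs-unique) (Anyₗ.there y∈xs) with y ≟ x
... | yes refl = contradiction y∈xs (All¬⇒¬Any x∉xs)
... | no  _    = trans (ℤ.+-identityˡ _) (∑-𝟙-∈ w xs-unique y∈xs)

range-unique : ∀ M → Unique (range (+ M))
range-unique M = Unique.map⁺ injective (Unique.upTo⁺ _)
  where
  injective : ∀ {i j} → + i - + M ≡ + j - + M → i ≡ j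
  injective {i} {j} eq = ℤ.+-injective (begin
    + i             ≡⟨ x-y+y≡x (+ i) (+ M) ⟨
    + i - + M + + M ≡⟨ cong (_+ + M) eq ⟩
    + j - + M + + M ≡⟨ x-y+y≡x (+ j) (+ M) ⟩
    + j             ∎)
    where open ≡-Reasoning

private
  y+M∈[0,2M] : ∀ {M} y → ∣ y ∣ ≤ M → Σ ℕ (λ t → (y + + M ≡ + t) Product.× (t ≤ M ℕ.+ M))
  y+M∈[0,2M] {M} (+ a)     a≤M   = a ℕ.+ M , refl , ℕ.+-monoˡ-≤ M a≤M
  y+M∈[0,2M] {M} -[1+ a ] 1+a≤M = M ℕ.∸ suc a , ℤ.⊖-≥ 1+a≤M , ℕ.≤-trans (ℕ.m∸n≤m M (suc a)) (ℕ.m≤m+n M M)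

∈-range⁺ : ∀ {M} y → ∣ y ∣ ≤ M → y ∈ range (+ M)
∈-range⁺ {M} y ∣y∣≤M with y+M∈[0,2M] y ∣y∣≤M
... | t , y+M≡t , t≤M+M = subst (_∈ range (+ M)) +t-M≡y (∈-map⁺ (λ i → + i - + M) (∈-upTo⁺ (s≤s t≤M+M)))
  where
  y+m-m≡y : ∀ y m → y + m - m ≡ y
  y+m-m≡y = solve-∀
  +t-M≡y : + t - + M ≡ y
  +t-M≡y = trans (cong (_- + M) (sym y+M≡t)) (y+m-m≡y y (+ M))

∈-range⁻ : ∀ {M y} → y ∈ range (+ M) → ∣ y ∣ ≤ M
∈-range⁻ {M} y∈ with ∈-map⁻ (λ i → + i - + M) y∈
... | i , i∈ , refl = subst (_≤ M) (cong ∣_∣ (sym (ℤ.m-n≡m⊖n i M))) (∣i⊖M∣≤M (ℕ.≤-pred (∈-upTo⁻ i∈)))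
  where
  ∣i⊖M∣≤M : i ≤ M ℕ.+ M → ∣ i ⊖ℕ M ∣ ≤ M
  ∣i⊖M∣≤M i≤M+M with ℕ.≤-total M i
  ... | inj₁ M≤i = subst (_≤ M) (trans (sym (ℤ.∣⊖∣-≤ M≤i)) (ℤ.∣m⊖n∣≡∣n⊖m∣ M i))
                          (ℕ.m≤n+o⇒m∸n≤o i M i≤M+M)
  ... | inj₂ i≤M = subst (_≤ M) (sym (ℤ.∣⊖∣-≤ i≤M)) (ℕ.m∸n≤m M i)

range-sift : ∀ M (w : ℤ → ℤ) y → (M < ∣ y ∣ → w y ≡ + 0) → ∑[ x ∈ range (+ M) ] 𝟙 (y ≟ x) * w x ≡ w y
range-sift M w y vanishes with ∣ y ∣ ℕ.≤? M
... | yes ∣y∣≤M = ∑-𝟙-∈ {y = y} w (range-unique M) (∈-range⁺ y ∣y∣≤M)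
... | no  ∣y∣≰M = trans (∑-𝟙-∉ {y = y} (range (+ M)) w (λ y∈ → ∣y∣≰M (∈-range⁻ y∈)))
                        (sym (vanishes (ℕ.≰⇒> ∣y∣≰M)))

cube-sift : ∀ r M (W : Vec ℤ r → ℤ) → (∀ v → Outside M v → W v ≡ + 0) →
            ∀ v → ∑[ j ∈ T r (+ M) ] W j * δ j v ≡ W v
cube-sift zero    M W _ [] = trans (ℤ.+-identityʳ _) (ℤ.*-identityʳ (W []))
cube-sift (suc r) M W vanishes (y ∷ u) = begin
  ∑[ j ∈ T (suc r) (+ M) ] W j * δ j (y ∷ u)
    ≡⟨ ∑-concatMap (λ x → List.map (x ∷_) Tʳ) R (λ j → W j * δ j (y ∷ u)) ⟩
  ∑[ x ∈ R ] ∑[ j ∈ List.map (x ∷_) Tʳ ] W j * δ j (y ∷ u)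
    ≡⟨ ∑-cong R (λ x → ∑-map (x ∷_) Tʳ (λ j → W j * δ j (y ∷ u))) ⟩
  ∑[ x ∈ R ] ∑[ j ∈ Tʳ ] W (x ∷ j) * δ (x ∷ j) (y ∷ u)
    ≡⟨ ∑-cong R (λ x → ∑-cong Tʳ (λ j → split x j)) ⟩
  ∑[ x ∈ R ] ∑[ j ∈ Tʳ ] 𝟙 (y ≟ x) * (W (x ∷ j) * δ j u)
    ≡⟨ ∑-cong R (λ x → ∑-*ˡ Tʳ (𝟙 (y ≟ x)) (λ j → W (x ∷ j) * δ j u)) ⟩
  ∑[ x ∈ R ] 𝟙 (y ≟ x) * (∑[ j ∈ Tʳ ] W (x ∷ j) * δ j u)
    ≡⟨ ∑-cong R (λ x → cong (𝟙 (y ≟ x) *_) (sift-tail x)) ⟩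
  ∑[ x ∈ R ] 𝟙 (y ≟ x) * W (x ∷ u)
    ≡⟨ range-sift M (λ x → W (x ∷ u)) y (λ M<∣y∣ → vanishes (y ∷ u) (here M<∣y∣)) ⟩
  W (y ∷ u) ∎
  where
  open ≡-Reasoning
  R = range (+ M)
  Tʳ = T r (+ M)
  split : ∀ x j → W (x ∷ j) * δ (x ∷ j) (y ∷ u) ≡ 𝟙 (y ≟ x) * (W (x ∷ j) * δ j u)
  split x j = trans (cong (W (x ∷ j) *_) (δ-∷ x y j u)) (x*[y*z]≡y*[x*z] (W (x ∷ j)) (𝟙 (y ≟ x)) (δ j u))
  sift-tail : ∀ x → ∑[ j ∈ Tʳ ] W (x ∷ j) * δ j u ≡ W (x ∷ u)
  sift-tail x = cube-sift r M (λ v → W (x ∷ v)) (λ v out → vanishes (x ∷ v) (there out)) u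

∈-cube⁻ : ∀ r R (v : Vec ℤ r) → v ∈ cube r R → All (_∈ R) v
∈-cube⁻ zero    R []  _  = []
∈-cube⁻ (suc r) R v   v∈ with find (∈-concatMap⁻ (λ x → List.map (x ∷_) (cube r R)) {xs = R} v∈)
... | x , x∈R , v∈xC with ∈-map⁻ (x ∷_) v∈xC
...   | w , w∈C , refl = x∈R ∷ ∈-cube⁻ r R w w∈C

∈-T⁻ : ∀ {M} (v : Vec ℤ r) → v ∈ T r (+ M) → Inside M v
∈-T⁻ {r} {M} v v∈T = All.map ∈-range⁻ (∈-cube⁻ r (range (+ M)) v v∈T)
Outside-i⊖p·j : ∀ {M k p} → k < p → (i j : Vec ℤ r) → Inside M i → Outside M j →
                Outside (k ℕ.* (M ℕ.+ 1)) (i ⊖ p · j)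
Outside-i⊖p·j {M = M} {k} {p} k<p (x ∷ i) (y ∷ j) (∣x∣≤M ∷ _) (here M<∣y∣) =
  here (subst (k ℕ.* (M ℕ.+ 1) <_) (ℤ.∣i-j∣≡∣j-i∣ (+ p * y) x) (<∣x-y∣ (+ p * y) x ∣x∣≤M M+K<∣py∣))
  where
  K = k ℕ.* (M ℕ.+ 1)
  M+K<∣py∣ : M ℕ.+ K < ∣ + p * y ∣
  M+K<∣py∣ = begin-strict
    M ℕ.+ K              <⟨ ℕ.+-monoˡ-< K (ℕ.m<m+n M (s≤s z≤n)) ⟩
    suc k ℕ.* (M ℕ.+ 1)  ≤⟨ ℕ.*-monoˡ-≤ (M ℕ.+ 1) k<p ⟩
    p ℕ.* (M ℕ.+ 1)      ≤⟨ ℕ.*-monoʳ-≤ p (subst (_≤ ∣ y ∣) (ℕ.+-comm 1 M) M<∣y∣) ⟩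
    p ℕ.* ∣ y ∣          ≡⟨ ℤ.∣i*j∣≡∣i∣*∣j∣ (+ p) y ⟨
    ∣ + p * y ∣          ∎
    where open ℕ.≤-Reasoning
Outside-i⊖p·j k<p (x ∷ i) (y ∷ j) (_ ∷ i≤M) (there out) = there (Outside-i⊖p·j k<p i j i≤M out)

γ-Outside : ∀ (P : LaurentPoly r) {p M k} → DegLE P (+ M + + 1) → k < p →
            ∀ {i j} → Inside M i → Outside M j → γ P p k i j ≡ + 0
γ-Outside P {p} {k = k} degP k<p {i} {j} i≤M j>M =
  coeff-pow-Outside degP k (-ᵛ (i ⊖ p · j)) (Outside-ᵛ (i ⊖ p · j) (Outside-i⊖p·j k<p i j i≤M j>M))

matVec-γ-V : ∀ (P : LaurentPoly r) {p M} → DegLE P (+ M + + 1) → ∀ n {k} → k < p → ∀ {i} → Inside M i →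
             matVec (T r (+ M)) (γ P p k) (V P n) i ≡ ⟦ pow P n ⟧ (λ g → coeff (pow P k) (-ᵛ i ⊖ p · g))
matVec-γ-V {r} P {p} {M} degP n {k} k<p {i} i≤M = begin
  ∑[ j ∈ T r (+ M) ] γ P p k i j * coeff Q (-ᵛ j)
    ≡⟨ ∑-cong (T r (+ M)) (λ j → cong (γ P p k i j *_) (coeff≡⟦⟧δ Q (-ᵛ j))) ⟩
  ∑[ j ∈ T r (+ M) ] γ P p k i j * ⟦ Q ⟧ (δ (-ᵛ j))
    ≡⟨ ∑-cong (T r (+ M)) (λ j → ⟦⟧-*ˡ Q (γ P p k i j) (δ (-ᵛ j))) ⟨
  ∑[ j ∈ T r (+ M) ] ⟦ Q ⟧ (λ g → γ P p k i j * δ (-ᵛ j) g)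
    ≡⟨ ∑-⟦⟧-comm (T r (+ M)) Q (λ j g → γ P p k i j * δ (-ᵛ j) g) ⟩
  ⟦ Q ⟧ (λ g → ∑[ j ∈ T r (+ M) ] γ P p k i j * δ (-ᵛ j) g)
    ≡⟨ ⟦⟧-cong Q (λ g → ∑-cong (T r (+ M)) (λ j → cong (γ P p k i j *_) (δ-ᵛ j g))) ⟩
  ⟦ Q ⟧ (λ g → ∑[ j ∈ T r (+ M) ] γ P p k i j * δ j (-ᵛ g))
    ≡⟨ ⟦⟧-cong Q (λ g → cube-sift r M (γ P p k i) γ-vanishes (-ᵛ g)) ⟩
  ⟦ Q ⟧ (λ g → coeff R (-ᵛ (i ⊖ p · -ᵛ g)))
    ≡⟨ ⟦⟧-cong Q (λ g → cong (coeff R) (-ᵛ[e⊖p·-ᵛg]≡-ᵛe⊖p·g p i g)) ⟩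
  ⟦ Q ⟧ (λ g → coeff R (-ᵛ i ⊖ p · g)) ∎
  where
  open ≡-Reasoning
  Q = pow P n
  R = pow P k
  γ-vanishes : ∀ j → Outside M j → γ P p k i j ≡ + 0
  γ-vanishes j = γ-Outside P degP k<p i≤M

γ·V≡V : ∀ (P : LaurentPoly r) {p} → Prime p → ∀ {M} → DegLE P (+ M + + 1) → ∀ n {k} → k < p →
        ∀ i → i ∈ T r (+ M) → matVec (T r (+ M)) (γ P p k) (V P n) i ≡ V P (p ℕ.* n ℕ.+ k) i [mod p ]
γ·V≡V P {p} p-prime degP n {k} k<p i i∈T =
  ≡[mod] (≋-trans (≡⇒≋ (matVec-γ-V P degP n k<p (∈-T⁻ i i∈T))) (≋-sym (V-p*n+k P n k i)))
  where
  open Modulo p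
  open FrobeniusLaurent p-prime

lemma9 : (r : ℕ) (P : LaurentPoly r) (p : ℕ) → Prime p → (m : ℤ) → DegLE P (m + + 1) →
         (n k : ℕ) → k < p → (i : Vec ℤ r) → i ∈ T r m →
         matVec (T r m) (γ P p k) (V P n) i ≡ V P (p Data.Nat.* n Data.Nat.+ k) i [mod p ]
-- For m < 0 the cube T r m is empty unless r = 0, where it is the one-point cube T 0 0.
lemma9 r       P p p-prime (+ M)    degP n k k<p i  i∈T = γ·V≡V P p-prime degP n k<p i i∈T
lemma9 zero    P p p-prime -[1+ M ] _    n k k<p [] i∈T = γ·V≡V P p-prime {M = 0} (λ { [] _ → [] }) n k<p [] i∈T
lemma9 (suc r) P p p-prime -[1+ M ] _    n k k<p i  ()
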